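{- Let $\mathbb{F}$ be any field, $V$ a finite-dimensional vector space over $\mathbb{F}$, $A\subseteq V$ and $n\in\mathbb{Z}_{\ge1}$. Then $\overline{A}^{(n)}\subseteq\operatorname{span}A^{(n)}$, where the span is taken in $V^{\otimes n}$.
   Context: For $B\subseteq V$, $B^{(n)}=\{T^{\otimes n}:T\in B\}\subseteq V^{\otimes n}$. The Zariski-closure of $A$ is $\overline{A}=\{T\in V:\ \forall f\in\mathbb{F}[V],\ f|_A\equiv0\Rightarrow f(T)=0\}$, where $\mathbb{F}[V]$ denotes the polynomial functions on $V$. -}

module Defs where

open import Level using (Level; _⊔_) renaming (suc to lsuc)
open import Data.Nat using (ℕ; zero; suc)
open import Data.Fin using (Fin) renaming (zero to fzero; suc to fsuc)
open import Data.Product using (Σ; ∃; _×_; _,_)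
open import Relation.Nullary using (¬_)
open import Relation.Unary using (Pred; _∈_)
open import Algebra.Bundles using (CommutativeRing)

record Field (c ℓ : Level) : Set (lsuc (c ⊔ ℓ)) where
  field
    commutativeRing : CommutativeRing c ℓ
  open CommutativeRing commutativeRing public
  field
    0≉1 : ¬ (0# ≈ 1#)
    inverse : ∀ x → ¬ (x ≈ 0#) → ∃ λ y → (x * y) ≈ 1#

module FieldDefs {c ℓ : Level} (F : Field c ℓ) where
  open Field F using (Carrier; _≈_; _+_; _*_; 0#; 1#)

  ∑ : ∀ {k} → (Fin k → Carrier) → Carrier
  ∑ {zero}  f = 0#
  ∑ {suc k} f = f fzero + ∑ (λ j → f (fsuc j))

  ∏ : ∀ {k} → (Fin k → Carrier) → Carrier
  ∏ {zero}  f = 1#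
  ∏ {suc k} f = f fzero * ∏ (λ j → f (fsuc j))

  Vect : ℕ → Set c
  Vect d = Fin d → Carrier

  -- The tensor power V^{⊗n} = F^{d^n}, with coordinates indexed by
  -- multi-indices (i₁,…,iₙ) ∈ (Fin d)^n.
  Tensor : ℕ → ℕ → Set c
  Tensor d n = (Fin n → Fin d) → Carrier

  _≈ᵀ_ : ∀ {d n} → Tensor d n → Tensor d n → Set ℓ
  S ≈ᵀ T = ∀ i → S i ≈ T i

  tensorPow : ∀ {d} (n : ℕ) → Vect d → Tensor d n
  tensorPow n T i = ∏ (λ k → T (i k))

  TensorPowSet : ∀ {a d} (n : ℕ) → Pred (Vect d) a → Pred (Tensor d n) (c ⊔ ℓ ⊔ a)
  TensorPowSet n B S = Σ _ λ T → T ∈ B × (S ≈ᵀ tensorPow n T)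

  Span : ∀ {b d n} → Pred (Tensor d n) b → Pred (Tensor d n) (c ⊔ ℓ ⊔ b)
  Span {d = d} {n = n} B S =
    Σ ℕ λ k → Σ (Fin k → Carrier) λ coef → Σ (Fin k → Tensor d n) λ v →
      (∀ j → v j ∈ B) × (S ≈ᵀ (λ i → ∑ (λ j → coef j * v j i)))

  -- Polynomials in d variables over F (syntax) and their evaluation;
  -- the polynomial functions F[V] are exactly the functions eval f.
  data Poly (d : ℕ) : Set c where
    var  : Fin d → Poly d
    con  : Carrier → Poly d
    _⊕_  : Poly d → Poly d → Poly d
    _⊗_  : Poly d → Poly d → Poly d

  eval : ∀ {d} → Poly d → Vect d → Carrier
  eval (var i) x = x i
  eval (con a) x = a
  eval (f ⊕ g) x = eval f x + eval g x
  eval (f ⊗ g) x = eval f x * eval g x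

  Closure : ∀ {a d} → Pred (Vect d) a → Pred (Vect d) (c ⊔ ℓ ⊔ a)
  Closure {d = d} A T =
    (f : Poly d) → (∀ S → S ∈ A → eval f S ≈ 0#) → eval f T ≈ 0#

-- Either T^{⊗n} lies in the span of A^{(n)}, or some linear functional on V^{⊗n} vanishes on
-- A^{(n)} but not at T^{⊗n}. This dichotomy holds for any set of vectors in a finite-dimensional
-- space, by Gaussian elimination over the coordinates one at a time (excluded middle decides
-- whether a pivot exists). Since the coordinates of S^{⊗n} are monomials in S, such a functional
-- would be a polynomial vanishing on A but not at T, contradicting T ∈ Ā.
module Submission where

open import Defs
open import Level using (Level; _⊔_)
open import Data.Nat using (ℕ; _≤_; zero; suc)
open import Data.Fin using (Fin) renaming (zero to fzero; suc to fsuc)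
open import Data.List using (List; []; _∷_; length; lookup; allFin; cartesianProductWith)
open import Data.List.Relation.Unary.All as All using (All; []; _∷_)
open import Data.List.Relation.Unary.Any using (here)
open import Data.List.Membership.Propositional using () renaming (_∈_ to _∈ₗ_)
open import Data.List.Membership.Propositional.Properties
  using (∈-cartesianProductWith⁺; ∈-allFin; ∈-lookup)
open import Data.Vec.Functional as Vector using ()
open import Data.Product using (∃; _×_; _,_; proj₁; proj₂)
open import Data.Sum using (_⊎_; inj₁; inj₂)
open import Data.Empty using (⊥-elim)
open import Function using (_∘_; case_of_)
open import Relation.Nullary using (¬_; yes; no)
open import Relation.Unary using (Pred; _∈_)
open import Relation.Binary.PropositionalEquality using (_≡_; _≗_; refl; cong)
open import Axiom.ExcludedMiddle using (ExcludedMiddle)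
open import Axiom.DoubleNegationElimination using (em⇒dne)

module LinearSeparation {c ℓ : Level} (F : Field c ℓ) (I : Set) where
  open Field F renaming (refl to ≈-refl)
  open import Algebra.Solver.Ring.NaturalCoefficients.Default commutativeSemiring
    using (solve; _:=_; _:+_; _:*_)
  open import Algebra.Properties.Ring ring using (-‿distribˡ-*; -‿distribʳ-*)
  open import Algebra.Properties.AbelianGroup +-abelianGroup using (xyx⁻¹≈y)
  open import Relation.Binary.Reasoning.Setoid setoid

  V : Set c
  V = I → Carrier

  combination : List (Carrier × V) → V
  combination []             i = 0#
  combination ((a , w) ∷ xs) i = a * w i + combination xs i

  pairing : List (Carrier × I) → V → Carrier
  pairing []             x = 0#
  pairing ((a , i) ∷ φ) x = a * x i + pairing φ x

  coordinate : I → List (Carrier × I)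
  coordinate i = (1# , i) ∷ []

  SpannedOn : ∀ {b} → Pred V b → List I → V → Set (c ⊔ ℓ ⊔ b)
  SpannedOn W L v =
    ∃ λ xs → All ((_∈ W) ∘ proj₂) xs × All (λ i → v i ≈ combination xs i) L

  Separates : ∀ {b} → List (Carrier × I) → Pred V b → V → Set (c ⊔ ℓ ⊔ b)
  Separates φ W v = (∀ w → w ∈ W → pairing φ w ≈ 0#) × ¬ (pairing φ v ≈ 0#)

  Separable : ∀ {b} → Pred V b → V → Set (c ⊔ ℓ ⊔ b)
  Separable W v = ∃ λ φ → Separates φ W v

  combination-vanishes : ∀ {i} xs → All (λ q → proj₂ q i ≈ 0#) xs → combination xs i ≈ 0#
  combination-vanishes []             []         = ≈-refl
  combination-vanishes ((a , w) ∷ xs) (w≈0 ∷ rest) =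
    trans (+-cong (trans (*-congˡ w≈0) (zeroʳ a)) (combination-vanishes xs rest)) (+-identityʳ 0#)

  pairing-coordinate : ∀ i x → pairing (coordinate i) x ≈ x i
  pairing-coordinate i x = trans (+-identityʳ _) (*-identityˡ _)

  pairing-axpy : ∀ φ (x z : V) k → pairing φ (λ i → x i + k * z i) ≈ pairing φ x + k * pairing φ z
  pairing-axpy []             x z k = sym (trans (+-identityˡ _) (zeroʳ k))
  pairing-axpy ((a , i) ∷ φ) x z k = begin
    a * (x i + k * z i) + pairing φ (λ j → x j + k * z j)   ≈⟨ +-congˡ (pairing-axpy φ x z k) ⟩
    a * (x i + k * z i) + (pairing φ x + k * pairing φ z)
      ≈⟨ solve 6 (λ a xi k zi X Z → a :* (xi :+ k :* zi) :+ (X :+ k :* Z) := (a :* xi :+ X) :+ k :* (a :* zi :+ Z))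
               ≈-refl a (x i) k (z i) (pairing φ x) (pairing φ z) ⟩
    (a * x i + pairing φ x) + k * (a * z i + pairing φ z)  ∎

  extend-without-pivot : (∀ {p} → ExcludedMiddle p) → ∀ {b} {W : Pred V b} {L v i₀} →
    (∀ w → w ∈ W → w i₀ ≈ 0#) →
    SpannedOn W L v ⊎ Separable W v → SpannedOn W (i₀ ∷ L) v ⊎ Separable W v
  extend-without-pivot lem W≈0 (inj₂ separated) = inj₂ separated
  extend-without-pivot lem {v = v} {i₀} W≈0 (inj₁ (xs , xs⊆W , agree)) with lem {P = v i₀ ≈ 0#}
  ... | yes v≈0 =
    inj₁ (xs , xs⊆W , trans v≈0 (sym (combination-vanishes xs (All.map (W≈0 _) xs⊆W))) ∷ agree)
  ... | no v≉0 =
    inj₂ (coordinate i₀ , (λ w w∈W → trans (pairing-coordinate i₀ w) (W≈0 w w∈W))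
                        , v≉0 ∘ trans (sym (pairing-coordinate i₀ v)))

  -- Gaussian elimination of coordinate i₀ with pivot p. The multiplier is written x i₀ * - y
  -- so that the ring identities below are negation-free (- y is an atom for the solver).
  module Pivot (i₀ : I) (p : V) {y : Carrier} (py≈1 : p i₀ * y ≈ 1#) where

    eliminate : V → V
    eliminate x i = x i + x i₀ * - y * p i

    Image : ∀ {b} → Pred V b → Pred V (c ⊔ b)
    Image W u = ∃ λ w → w ∈ W × u ≡ eliminate w

    pullback : List (Carrier × I) → List (Carrier × I)
    pullback φ = (- y * pairing φ p , i₀) ∷ φ

    scale-pivot : ∀ a → a * y * p i₀ ≈ a
    scale-pivot a = begin
      a * y * p i₀    ≈⟨ solve 3 (λ a y q → a :* y :* q := a :* (q :* y)) ≈-refl a y (p i₀) ⟩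
      a * (p i₀ * y)  ≈⟨ *-congˡ py≈1 ⟩
      a * 1#          ≈⟨ *-identityʳ a ⟩
      a               ∎

    neg-multiplier : ∀ a i → a * - y * p i ≈ - (a * y * p i)
    neg-multiplier a i = trans (*-congʳ (sym (-‿distribʳ-* a y))) (sym (-‿distribˡ-* (a * y) (p i)))

    eliminate-pivot : ∀ x → eliminate x i₀ ≈ 0#
    eliminate-pivot x = begin
      x i₀ + x i₀ * - y * p i₀     ≈⟨ +-congˡ (neg-multiplier (x i₀) i₀) ⟩
      x i₀ + - (x i₀ * y * p i₀)   ≈⟨ +-congˡ (-‿cong (scale-pivot (x i₀))) ⟩
      x i₀ + - x i₀                ≈⟨ -‿inverseʳ (x i₀) ⟩
      0#                           ∎

    Image-pivot : ∀ {b} {W : Pred V b} {u} → u ∈ Image W → u i₀ ≈ 0#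
    Image-pivot (w , _ , refl) = eliminate-pivot w

    pairing-pullback : ∀ φ x → pairing (pullback φ) x ≈ pairing φ (eliminate x)
    pairing-pullback φ x = begin
      - y * pairing φ p * x i₀ + pairing φ x
        ≈⟨ solve 4 (λ m P X Q → m :* P :* X :+ Q := Q :+ X :* m :* P) ≈-refl (- y) (pairing φ p) (x i₀) (pairing φ x) ⟩
      pairing φ x + x i₀ * - y * pairing φ p   ≈⟨ sym (pairing-axpy φ x p (x i₀ * - y)) ⟩
      pairing φ (eliminate x)                  ∎

    -- eliminate w is the combination w + (w i₀ * - y) p of two vectors of W.
    unEliminate : ∀ {b} {W : Pred V b} → p ∈ W → ∀ xs → All ((_∈ Image W) ∘ proj₂) xs →
      ∃ λ ys → All ((_∈ W) ∘ proj₂) ys × (∀ i → combination ys i ≈ combination xs i)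
    unEliminate p∈W [] [] = [] , [] , λ _ → ≈-refl
    unEliminate p∈W ((a , _) ∷ xs) ((w , w∈W , refl) ∷ rest) with unEliminate p∈W xs rest
    ... | ys , ys⊆W , ys≈xs =
      (a , w) ∷ (a * (w i₀ * - y) , p) ∷ ys , w∈W ∷ p∈W ∷ ys⊆W , λ i → begin
        a * w i + (a * (w i₀ * - y) * p i + combination ys i)   ≈⟨ +-congˡ (+-congˡ (ys≈xs i)) ⟩
        a * w i + (a * (w i₀ * - y) * p i + combination xs i)
          ≈⟨ solve 6 (λ a wi k m q C → a :* wi :+ (a :* (k :* m) :* q :+ C) := a :* (wi :+ k :* m :* q) :+ C)
                   ≈-refl a (w i) (w i₀) (- y) (p i) (combination xs i) ⟩
        a * eliminate w i + combination xs i                    ∎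

    extend-with-pivot : ∀ {b} {W : Pred V b} {L v} → p ∈ W →
      SpannedOn (Image W) L (eliminate v) ⊎ Separable (Image W) (eliminate v) →
      SpannedOn W (i₀ ∷ L) v ⊎ Separable W v
    extend-with-pivot {v = v} p∈W (inj₂ (φ , φW≈0 , φv≉0)) =
      inj₂ (pullback φ , (λ w w∈W → trans (pairing-pullback φ w) (φW≈0 _ (w , w∈W , refl)))
                       , φv≉0 ∘ trans (sym (pairing-pullback φ v)))
    extend-with-pivot {v = v} p∈W (inj₁ (xs , xs⊆W′ , agree)) with unEliminate p∈W xs xs⊆W′
    ... | ys , ys⊆W , ys≈xs =
      inj₁ ((v i₀ * y , p) ∷ ys , p∈W ∷ ys⊆W , at-pivot ∷ All.map off-pivot agree)
      where
      at-pivot : v i₀ ≈ v i₀ * y * p i₀ + combination ys i₀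
      at-pivot = sym (begin
        v i₀ * y * p i₀ + combination ys i₀   ≈⟨ +-cong (scale-pivot (v i₀)) (ys≈xs i₀) ⟩
        v i₀ + combination xs i₀              ≈⟨ +-congˡ (combination-vanishes xs (All.map Image-pivot xs⊆W′)) ⟩
        v i₀ + 0#                             ≈⟨ +-identityʳ (v i₀) ⟩
        v i₀                                  ∎)

      off-pivot : ∀ {i} → eliminate v i ≈ combination xs i → v i ≈ v i₀ * y * p i + combination ys i
      off-pivot {i} e = sym (begin
        v i₀ * y * p i + combination ys i             ≈⟨ +-congˡ (trans (ys≈xs i) (sym e)) ⟩
        v i₀ * y * p i + (v i + v i₀ * - y * p i)     ≈⟨ +-congˡ (+-congˡ (neg-multiplier (v i₀) i)) ⟩
        v i₀ * y * p i + (v i + - (v i₀ * y * p i))   ≈⟨ sym (+-assoc _ _ _) ⟩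
        v i₀ * y * p i + v i + - (v i₀ * y * p i)     ≈⟨ xyx⁻¹≈y _ _ ⟩
        v i                                           ∎)

  spannedOn-or-separable : (∀ {p} → ExcludedMiddle p) →
    ∀ {b} (W : Pred V b) L v → SpannedOn W L v ⊎ Separable W v
  spannedOn-or-separable lem W []        v = inj₁ ([] , [] , [])
  spannedOn-or-separable lem W (i₀ ∷ L) v with lem {P = ∃ λ p → p ∈ W × ¬ (p i₀ ≈ 0#)}
  ... | yes (p , p∈W , p≉0) =
    let y , py≈1 = inverse (p i₀) p≉0
        open Pivot i₀ p py≈1
    in extend-with-pivot p∈W (spannedOn-or-separable lem (Image W) L (eliminate v))
  ... | no ∄pivot = extend-without-pivot lem
    (λ w w∈W → em⇒dne lem (λ w≉0 → ∄pivot (w , w∈W , w≉0)))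
    (spannedOn-or-separable lem W L v)

-- Without function extensionality completeness only holds up to _≗_, which is why tensors
-- are later required to be IndexInvariant.
multiIndices : ∀ {d} n → List (Fin n → Fin d)
multiIndices         zero    = (λ ()) ∷ []
multiIndices {d = d} (suc n) = cartesianProductWith Vector._∷_ (allFin d) (multiIndices n)

multiIndices-complete : ∀ {d} n (i : Fin n → Fin d) → ∃ λ j → j ∈ₗ multiIndices n × j ≗ i
multiIndices-complete zero    i = (λ ()) , here refl , λ ()
multiIndices-complete (suc n) i with multiIndices-complete n (i ∘ fsuc)
... | j , j∈ , j≗i = i fzero Vector.∷ j
                   , ∈-cartesianProductWith⁺ Vector._∷_ (∈-allFin (i fzero)) j∈
                   , λ { fzero → refl ; (fsuc k) → j≗i k }

module Monomials {c ℓ : Level} (F : Field c ℓ) (d : ℕ) where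
  open Field F renaming (refl to ≈-refl)
  open FieldDefs F

  ∏-cong : ∀ {k} {f g : Fin k → Carrier} → (∀ j → f j ≈ g j) → ∏ f ≈ ∏ g
  ∏-cong {zero}  f≈g = ≈-refl
  ∏-cong {suc k} f≈g = *-cong (f≈g fzero) (∏-cong (f≈g ∘ fsuc))

  monomial : ∀ {m} → (Fin m → Fin d) → Poly d
  monomial {zero}  i = con 1#
  monomial {suc m} i = var (i fzero) ⊗ monomial (i ∘ fsuc)

  eval-monomial : ∀ {m} (i : Fin m → Fin d) x → eval (monomial i) x ≈ tensorPow m x i
  eval-monomial {zero}  i x = ≈-refl
  eval-monomial {suc m} i x = *-congˡ (eval-monomial (i ∘ fsuc) x)

module TensorPowers {c ℓ : Level} (F : Field c ℓ) (d n : ℕ) where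
  open Field F renaming (refl to ≈-refl)
  open FieldDefs F
  open Monomials F d
  open LinearSeparation F (Fin n → Fin d)

  IndexInvariant : Tensor d n → Set ℓ
  IndexInvariant S = ∀ {i j} → i ≗ j → S i ≈ S j

  tensorPow-invariant : ∀ T → IndexInvariant (tensorPow n T)
  tensorPow-invariant T i≗j = ∏-cong (reflexive ∘ cong T ∘ i≗j)

  TensorPowSet-invariant : ∀ {a} {A : Pred (Vect d) a} {S} → S ∈ TensorPowSet n A → IndexInvariant S
  TensorPowSet-invariant (T , _ , S≈T⊗ⁿ) {i} {j} i≗j =
    trans (S≈T⊗ⁿ i) (trans (tensorPow-invariant T i≗j) (sym (S≈T⊗ⁿ j)))

  combination-invariant : ∀ xs → All (IndexInvariant ∘ proj₂) xs → IndexInvariant (combination xs)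
  combination-invariant []             []               i≗j = ≈-refl
  combination-invariant ((a , w) ∷ xs) (w-inv ∷ xs-inv) i≗j =
    +-cong (*-congˡ (w-inv i≗j)) (combination-invariant xs xs-inv i≗j)

  agreeOn-multiIndices : ∀ {S S′} → IndexInvariant S → IndexInvariant S′ →
    All (λ i → S i ≈ S′ i) (multiIndices n) → S ≈ᵀ S′
  agreeOn-multiIndices S-inv S′-inv agree i with multiIndices-complete n i
  ... | j , j∈ , j≗i = trans (sym (S-inv j≗i)) (trans (All.lookup agree j∈) (S′-inv j≗i))

  combination≈∑ : ∀ xs i → combination xs i ≈ ∑ (λ j → proj₁ (lookup xs j) * proj₂ (lookup xs j) i)
  combination≈∑ []       i = ≈-refl
  combination≈∑ (x ∷ xs) i = +-congˡ (combination≈∑ xs i)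

  combination∈Span : ∀ {b} {W : Pred (Tensor d n) b} {S} xs → All ((_∈ W) ∘ proj₂) xs →
    S ≈ᵀ combination xs → S ∈ Span W
  combination∈Span xs xs⊆W S≈xs =
    length xs , proj₁ ∘ lookup xs , proj₂ ∘ lookup xs , All.lookup xs⊆W ∘ ∈-lookup ,
    λ i → trans (S≈xs i) (combination≈∑ xs i)

  polynomial : List (Carrier × (Fin n → Fin d)) → Poly d
  polynomial []             = con 0#
  polynomial ((a , i) ∷ φ) = (con a ⊗ monomial i) ⊕ polynomial φ

  eval-polynomial : ∀ φ x → eval (polynomial φ) x ≈ pairing φ (tensorPow n x)
  eval-polynomial []             x = ≈-refl
  eval-polynomial ((a , i) ∷ φ) x = +-cong (*-congˡ (eval-monomial i x)) (eval-polynomial φ x)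

  pairing-tensorPow-closure : ∀ {a} {A : Pred (Vect d) a} {T} φ →
    (∀ S → S ∈ TensorPowSet n A → pairing φ S ≈ 0#) → T ∈ Closure A →
    pairing φ (tensorPow n T) ≈ 0#
  pairing-tensorPow-closure {T = T} φ φA⁽ⁿ⁾≈0 T∈Ā =
    trans (sym (eval-polynomial φ T))
      (T∈Ā (polynomial φ) λ S S∈A →
        trans (eval-polynomial φ S) (φA⁽ⁿ⁾≈0 _ (S , S∈A , λ _ → ≈-refl)))

lemma2p3 : (lem : ∀ {p} → ExcludedMiddle p)
    → {c ℓ a : Level} (F : Field c ℓ) (d : ℕ)
    → (A : Pred (FieldDefs.Vect F d) a) (n : ℕ) → 1 ≤ n
    → (T : FieldDefs.Vect F d) → T ∈ FieldDefs.Closure F A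
    → FieldDefs.tensorPow F n T ∈ FieldDefs.Span F (FieldDefs.TensorPowSet F n A)
lemma2p3 lem F d A n _ T T∈Ā =
  case spannedOn-or-separable lem (TensorPowSet n A) (multiIndices n) (tensorPow n T) of λ where
    (inj₁ (xs , xs⊆A⁽ⁿ⁾ , agree)) →
      combination∈Span xs xs⊆A⁽ⁿ⁾
        (agreeOn-multiIndices (tensorPow-invariant T)
          (combination-invariant xs (All.map TensorPowSet-invariant xs⊆A⁽ⁿ⁾)) agree)
    (inj₂ (φ , φA⁽ⁿ⁾≈0 , φT⊗ⁿ≉0)) →
      ⊥-elim (φT⊗ⁿ≉0 (pairing-tensorPow-closure φ φA⁽ⁿ⁾≈0 T∈Ā))
  where
  open FieldDefs F
  open LinearSeparation F (Fin n → Fin d)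
  open TensorPowers F d n
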